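{- Let $a,b$ be positive integers, let $A=(a,a)$ and $B=(b,b)$, and let $(S(i))_{i\ge 0}=(S_{A,B}(i))_{i\ge0}$ be the ordered Markov sequences for $A$ and $B$ (defined in the context). Then for every $i\ge 0$ the sequence $S(i)$ is evenly palindromic. Moreover, for every $i\ge0$ the circular shift $C_{d_i}(S(i))$ is palindromic, where $d_i$ is the $i$-th term of Stern's diatomic sequence.
   Context: For finite sequences $X=(x_1,\ldots,x_p)$ and $Y=(y_1,\ldots,y_q)$, $X\oplus Y=(x_1,\ldots,x_p,y_1,\ldots,y_q)$ denotes concatenation. For a triple $(X,Y,Z)$ of finite sequences put $\mathcal{L}(X,Y,Z)=(X,X\oplus Y,Y)$ and $\mathcal{R}(X,Y,Z)=(Y,Y\oplus Z,Z)$. Given finite sequences $A,B$, let $v=(A,A\oplus B,B)$. For $m\ge1$ the $2^m$ triples at depth $m$ are $\varepsilon_m(\cdots\varepsilon_2(\varepsilon_1(v))\cdots)$ for words $(\varepsilon_1,\ldots,\varepsilon_m)\in\{\mathcal{L},\mathcal{R}\}^m$ ($\varepsilon_1$ applied first), listed in lexicographic order of $(\varepsilon_1,\ldots,\varepsilon_m)$ with $\mathcal{L}<\mathcal{R}$. The ordered Markov sequences are $S(0)=A$, $S(1)=B$, $S(2)=A\oplus B$, and, for $m\ge1$ and $1\le i\le 2^m$, $S(2^m+i)$ is the middle component of the $i$-th triple at depth $m$. Stern's diatomic sequence: $d_0=0$, $d_1=1$, and $d_{2n}=d_n$, $d_{2n-1}=d_n+d_{n-1}$ for $n\ge1$. For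 a sequence $\Lambda=(\lambda_1,\ldots,\lambda_m)$ and $0\le j<m$, the $j$-th circular shift is $C_j(\Lambda)=(\lambda_{j+1},\ldots,\lambda_m,\lambda_1,\ldots,\lambda_j)$. A sequence is palindromic if it equals its reverse. A sequence $(\lambda_1,\ldots,\lambda_{2n})$ of even length is evenly palindromic if there is $k\in\mathbb{Z}$ such that $\lambda_{(k+i)\bmod 2n}=\lambda_{(k-i-1)\bmod 2n}$ for all $i\in\mathbb{Z}$ (indices taken modulo $2n$ in $\{1,\ldots,2n\}$). -}

module Defs where

open import Data.Nat using (ℕ; zero; suc; _+_; _*_; _^_; _∸_; _≤ᵇ_)
open import Data.Nat.DivMod using (_/_; _%_)
open import Data.Bool using (Bool; true; false; if_then_else_)
open import Data.List using (List; []; _∷_; _++_; length; reverse; take; drop)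
open import Data.Maybe using (Maybe; just; nothing)
open import Data.Product using (_×_; _,_; ∃)
open import Data.Integer as ℤ using (ℤ; +_)
open import Data.Integer.DivMod using () renaming (_%_ to _%ℤ_)
open import Relation.Binary.PropositionalEquality using (_≡_)

_⊕_ : List ℕ → List ℕ → List ℕ
X ⊕ Y = X ++ Y

Triple : Set
Triple = List ℕ × List ℕ × List ℕ

middle : Triple → List ℕ
middle (_ , Y , _) = Y

opL : Triple → Triple
opL (X , Y , Z) = (X , X ⊕ Y , Y)

opR : Triple → Triple
opR (X , Y , Z) = (Y , Y ⊕ Z , Z)

data Dir : Set where
  L R : Dir

applyWord : List Dir → Triple → Triple
applyWord []       t = t
applyWord (L ∷ ws) t = applyWord ws (opL t)
applyWord (R ∷ ws) t = applyWord ws (opR t)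

-- the m-bit binary expansion of k, most significant bit first (0 ↦ L, 1 ↦ R).
-- For 0 ≤ k < 2^m this is the k-th word of {L,R}^m in lexicographic order (L < R).
bitsWord : ℕ → ℕ → List Dir
bitsWord zero    k = []
bitsWord (suc m) k =
  if (2 ^ m) ≤ᵇ k then R ∷ bitsWord m (k ∸ 2 ^ m)
                   else L ∷ bitsWord m k

-- the i-th triple at depth m (1 ≤ i ≤ 2^m), i.e. word number i-1
tripleAt : List ℕ → List ℕ → ℕ → ℕ → Triple
tripleAt A B m i = applyWord (bitsWord m (i ∸ 1)) (A , A ⊕ B , B)

-- For n ≥ 3, find m ≥ 1 and 1 ≤ i ≤ 2^m with n = 2^m + i, and return S(n).
-- 'fuel' bounds the search over m (starting at m = 1).
SAux : List ℕ → List ℕ → ℕ → ℕ → ℕ → List ℕ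
SAux A B zero       m n = []   -- never reached with enough fuel
SAux A B (suc fuel) m n =
  if n ≤ᵇ (2 ^ m) * 2
  then middle (tripleAt A B m (n ∸ 2 ^ m))
  else SAux A B fuel (suc m) n

S : List ℕ → List ℕ → ℕ → List ℕ
S A B 0 = A
S A B 1 = B
S A B 2 = A ⊕ B
S A B n@(suc (suc (suc _))) = SAux A B n 1 n

-- Stern's diatomic sequence, via the pair (d_n , d_{n+1}):
-- d_{2k} = d_k, d_{2k+1} = d_k + d_{k+1}.
sternPair : ℕ → ℕ → ℕ × ℕ
sternPair zero       n = (0 , 1)
sternPair (suc fuel) zero = (0 , 1)
sternPair (suc fuel) n@(suc _) with sternPair fuel (n / 2)
... | (x , y) = if (n % 2) ≤ᵇ 0 then (x , x + y) else (x + y , y)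

stern : ℕ → ℕ
stern n with sternPair n n
... | (x , _) = x

C : ℕ → List ℕ → List ℕ
C j Λ = drop j Λ ++ take j Λ

Palindromic : List ℕ → Set
Palindromic Λ = Λ ≡ reverse Λ

at : List ℕ → ℕ → Maybe ℕ
at []       _       = nothing
at (x ∷ xs) zero    = just x
at (x ∷ xs) (suc n) = at xs n

-- λ_r for r ∈ ℤ, with r taken modulo the length into {1,…,len}
-- (0-based position (r - 1) mod len)
atℤ : (Λ : List ℕ) → ℤ → Maybe ℕ
atℤ Λ r with length Λ
... | zero    = nothing
... | suc l   = at Λ ((r ℤ.- ℤ.1ℤ) %ℤ (+ suc l))

EvenlyPalindromic : List ℕ → Set
EvenlyPalindromic Λ =
  ∃ λ n → length Λ ≡ 2 * n ×
  ∃ λ (k : ℤ) → ∀ (i : ℤ) → atℤ Λ (k ℤ.+ i) ≡ atℤ Λ (k ℤ.- i ℤ.- ℤ.1ℤ)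

module Submission where

-- With α = A and β = B (palindromes of length 2), every triple reachable from (α, αβ, β) has the
-- form (αX′, αX′Z′β, Z′β) where Z′α and βX′ are palindromes and αX′Z′β = Z′αβX′; both L and R
-- preserve this form.  Hence every S(i) with i ≥ 2 is the product (Z′α)(βX′) of two palindromes.
-- Along the moves the outer lengths follow Stern's recursion d₂ₙ = dₙ, d₂ₙ₊₁ = dₙ + dₙ₊₁, which gives
-- |Z′α| = 2 dᵢ and |βX′| = 2 dᵢ₋₁.  Writing a palindrome U of length 2d as Dᴿ D, rotating U V by d
-- yields the palindrome D V Dᴿ; and a word whose rotation by j is a palindrome is evenly palindromic.

open import Defs
open import Data.Nat using (ℕ; _>_)
open import Data.List using (List; []; _∷_; _++_; length; reverse; take; drop; _∷ʳ_)
open import Data.List.Properties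
  using (++-monoid; ++-assoc; ++-identityʳ; ++-cancelˡ; ++-cancelʳ; reverse-++; reverse-involutive; unfold-reverse;
         length-++; length-++-comm; length-reverse; length-take; length-drop; take++drop≡id)
open import Data.Product using (_×_; _,_; proj₁; proj₂; ∃; ∃₂)
open import Relation.Binary.PropositionalEquality
open import Tactic.MonoidSolver using (solve)

module Diatomic where
  open import Data.Bool using (if_then_else_)
  open import Data.Nat
  open import Data.Nat.DivMod using (m/n<m; [m+kn]%n≡m%n; m*n%n≡0; m*n/n≡m; +-distrib-/-∣ʳ)
  open import Data.Nat.Divisibility using (m∣m*n)
  open import Data.Nat.Induction using (<-rec)
  open import Data.Nat.Properties
  open import Function using (_∘_)

  sternStep : ℕ → ℕ × ℕ → ℕ × ℕ
  sternStep r (x , y) = if r ≤ᵇ 0 then (x , x + y) else (x + y , y)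

  sternPair-suc : ∀ f n → sternPair (suc f) (suc n) ≡ sternStep (suc n % 2) (sternPair f (suc n / 2))
  sternPair-suc f n with sternPair f (suc n / 2)
  ... | _ = refl

  [1+n]/2≤n : ∀ n → suc n / 2 ≤ n
  [1+n]/2≤n n = <⇒≤pred (m/n<m (suc n) 2 (s≤s (s≤s z≤n)))

  sternPair-fuel : ∀ {f g n} → n ≤ f → n ≤ g → sternPair f n ≡ sternPair g n
  sternPair-fuel {zero}  {zero}  {zero}  _ _ = refl
  sternPair-fuel {zero}  {suc _} {zero}  _ _ = refl
  sternPair-fuel {suc _} {zero}  {zero}  _ _ = refl
  sternPair-fuel {suc _} {suc _} {zero}  _ _ = refl
  sternPair-fuel {suc f} {suc g} {suc n} (s≤s n≤f) (s≤s n≤g) = begin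
    sternPair (suc f) (suc n)                          ≡⟨ sternPair-suc f n ⟩
    sternStep (suc n % 2) (sternPair f (suc n / 2))
      ≡⟨ cong (sternStep (suc n % 2)) (sternPair-fuel (half≤ n≤f) (half≤ n≤g)) ⟩
    sternStep (suc n % 2) (sternPair g (suc n / 2))   ≡⟨ sternPair-suc g n ⟨
    sternPair (suc g) (suc n)                          ∎
    where
    open ≡-Reasoning
    half≤ : ∀ {k} → n ≤ k → suc n / 2 ≤ k
    half≤ = ≤-trans ([1+n]/2≤n n)

  2n%2≡0 : ∀ n → 2 * n % 2 ≡ 0
  2n%2≡0 n = trans (cong (_% 2) (*-comm 2 n)) (m*n%n≡0 n 2)

  2n/2≡n : ∀ n → 2 * n / 2 ≡ n
  2n/2≡n n = trans (cong (_/ 2) (*-comm 2 n)) (m*n/n≡m n 2)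

  [1+2n]%2≡1 : ∀ n → suc (2 * n) % 2 ≡ 1
  [1+2n]%2≡1 n = trans (cong (λ m → suc m % 2) (*-comm 2 n)) ([m+kn]%n≡m%n 1 n 2)

  [1+2n]/2≡n : ∀ n → suc (2 * n) / 2 ≡ n
  [1+2n]/2≡n n = trans (+-distrib-/-∣ʳ 1 {2 * n} (m∣m*n n)) (2n/2≡n n)

  diatomicPair : ℕ → ℕ × ℕ
  diatomicPair n = sternPair n n

  stern≡proj₁-diatomicPair : ∀ n → stern n ≡ proj₁ (diatomicPair n)
  stern≡proj₁-diatomicPair n with sternPair n n
  ... | _ = refl

  diatomicPair-suc : ∀ n → diatomicPair (suc n) ≡ sternStep (suc n % 2) (diatomicPair (suc n / 2))
  diatomicPair-suc n =
    trans (sternPair-suc n n) (cong (sternStep (suc n % 2)) (sternPair-fuel ([1+n]/2≤n n) ≤-refl))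

  diatomicPair-even : ∀ n → diatomicPair (2 * n) ≡ sternStep 0 (diatomicPair n)
  diatomicPair-even zero      = refl
  diatomicPair-even n@(suc m) = trans (diatomicPair-suc (m + 1 * n))
    (cong₂ sternStep (2n%2≡0 n) (cong diatomicPair (2n/2≡n n)))

  diatomicPair-odd : ∀ n → diatomicPair (suc (2 * n)) ≡ sternStep 1 (diatomicPair n)
  diatomicPair-odd n = trans (diatomicPair-suc (2 * n))
    (cong₂ sternStep ([1+2n]%2≡1 n) (cong diatomicPair ([1+2n]/2≡n n)))

  data ParityView : ℕ → Set where
    even : ∀ n → ParityView (2 * n)
    odd  : ∀ n → ParityView (suc (2 * n))

  parityView : ∀ n → ParityView n
  parityView zero = even 0
  parityView (suc n) with parityView n
  ... | even m = odd m
  ... | odd m  = subst ParityView (*-suc 2 m) (even (suc m))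

  diatomicPair-consecutive : ∀ n → proj₂ (diatomicPair n) ≡ proj₁ (diatomicPair (suc n))
  diatomicPair-consecutive = <-rec _ consecutive
    where
    consecutive : ∀ n → (∀ {m} → m < n → proj₂ (diatomicPair m) ≡ proj₁ (diatomicPair (suc m))) →
                  proj₂ (diatomicPair n) ≡ proj₁ (diatomicPair (suc n))
    consecutive n ih with parityView n
    ... | even m = trans (cong proj₂ (diatomicPair-even m)) (sym (cong proj₁ (diatomicPair-odd m)))
    ... | odd m  = begin
      proj₂ (diatomicPair (suc (2 * m)))       ≡⟨ cong proj₂ (diatomicPair-odd m) ⟩
      proj₂ (diatomicPair m)                   ≡⟨ ih (s≤s (m≤m+n m (m + 0))) ⟩
      proj₁ (diatomicPair (suc m))             ≡⟨ cong proj₁ (diatomicPair-even (suc m)) ⟨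
      proj₁ (diatomicPair (2 * suc m))         ≡⟨ cong (proj₁ ∘ diatomicPair) (*-suc 2 m) ⟩
      proj₁ (diatomicPair (suc (suc (2 * m)))) ∎
      where open ≡-Reasoning

  stern-double : ∀ n → stern (2 * n) ≡ stern n
  stern-double n = begin
    stern (2 * n)                      ≡⟨ stern≡proj₁-diatomicPair (2 * n) ⟩
    proj₁ (diatomicPair (2 * n))       ≡⟨ cong proj₁ (diatomicPair-even n) ⟩
    proj₁ (diatomicPair n)             ≡⟨ stern≡proj₁-diatomicPair n ⟨
    stern n                            ∎
    where open ≡-Reasoning

  stern-double+1 : ∀ n → stern (suc (2 * n)) ≡ stern n + stern (suc n)
  stern-double+1 n = begin
    stern (suc (2 * n))                              ≡⟨ stern≡proj₁-diatomicPair (suc (2 * n)) ⟩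
    proj₁ (diatomicPair (suc (2 * n)))               ≡⟨ cong proj₁ (diatomicPair-odd n) ⟩
    proj₁ (diatomicPair n) + proj₂ (diatomicPair n)
      ≡⟨ cong (proj₁ (diatomicPair n) +_) (diatomicPair-consecutive n) ⟩
    proj₁ (diatomicPair n) + proj₁ (diatomicPair (suc n))
      ≡⟨ cong₂ _+_ (stern≡proj₁-diatomicPair n) (stern≡proj₁-diatomicPair (suc n)) ⟨
    stern n + stern (suc n)                          ∎
    where open ≡-Reasoning

module Palindromes where
  open import Data.Nat
  open import Data.Nat.Properties

  reverse-++₃ : ∀ (xs ys zs : List ℕ) → reverse (xs ++ ys ++ zs) ≡ reverse zs ++ reverse ys ++ reverse xs
  reverse-++₃ xs ys zs = begin
    reverse (xs ++ ys ++ zs)                  ≡⟨ reverse-++ xs (ys ++ zs) ⟩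
    reverse (ys ++ zs) ++ reverse xs          ≡⟨ cong (_++ reverse xs) (reverse-++ ys zs) ⟩
    (reverse zs ++ reverse ys) ++ reverse xs  ≡⟨ solve (++-monoid ℕ) ⟩
    reverse zs ++ reverse ys ++ reverse xs    ∎
    where open ≡-Reasoning

  reverse-++-palindromes : ∀ {xs zs} → Palindromic xs → Palindromic zs →
                           ∀ ys → reverse (xs ++ ys ++ zs) ≡ zs ++ reverse ys ++ xs
  reverse-++-palindromes {xs} {zs} xs-pal zs-pal ys =
    trans (reverse-++₃ xs ys zs) (cong₂ (λ u v → u ++ reverse ys ++ v) (sym zs-pal) (sym xs-pal))

  palindromic-++ʳ : ∀ {xs ys} → Palindromic ys → Palindromic (xs ++ ys) → xs ++ ys ≡ ys ++ reverse xs
  palindromic-++ʳ {xs} {ys} ys-pal xsys-pal = begin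
    xs ++ ys                  ≡⟨ xsys-pal ⟩
    reverse (xs ++ ys)        ≡⟨ reverse-++ xs ys ⟩
    reverse ys ++ reverse xs  ≡⟨ cong (_++ reverse xs) ys-pal ⟨
    ys ++ reverse xs          ∎
    where open ≡-Reasoning

  palindromic-++ˡ : ∀ {xs ys} → Palindromic xs → Palindromic (xs ++ ys) → xs ++ ys ≡ reverse ys ++ xs
  palindromic-++ˡ {xs} {ys} xs-pal xsys-pal = begin
    xs ++ ys                  ≡⟨ xsys-pal ⟩
    reverse (xs ++ ys)        ≡⟨ reverse-++ xs ys ⟩
    reverse ys ++ reverse xs  ≡⟨ cong (reverse ys ++_) xs-pal ⟨
    reverse ys ++ xs          ∎
    where open ≡-Reasoning

  palindromic-conjugate : ∀ xs {ys} → Palindromic ys → Palindromic (xs ++ ys ++ reverse xs)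
  palindromic-conjugate xs {ys} ys-pal = begin
    xs ++ ys ++ reverse xs
      ≡⟨ cong₂ (λ u v → u ++ v ++ reverse xs) (sym (reverse-involutive xs)) ys-pal ⟩
    reverse (reverse xs) ++ reverse ys ++ reverse xs   ≡⟨ reverse-++₃ xs ys (reverse xs) ⟨
    reverse (xs ++ ys ++ reverse xs)                   ∎
    where open ≡-Reasoning

  drop-length-++ : ∀ (xs ys : List ℕ) → drop (length xs) (xs ++ ys) ≡ ys
  drop-length-++ []       ys = refl
  drop-length-++ (x ∷ xs) ys = drop-length-++ xs ys

  take-length-++ : ∀ (xs ys : List ℕ) → take (length xs) (xs ++ ys) ≡ xs
  take-length-++ []       ys = refl
  take-length-++ (x ∷ xs) ys = cong (x ∷_) (take-length-++ xs ys)

  rotate-length-++ : ∀ (xs ys : List ℕ) → C (length xs) (xs ++ ys) ≡ ys ++ xs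
  rotate-length-++ xs ys = cong₂ _++_ (drop-length-++ xs ys) (take-length-++ xs ys)

  ++-injectiveˡ : ∀ {xs xs′ ys ys′ : List ℕ} → length xs ≡ length xs′ →
                  xs ++ ys ≡ xs′ ++ ys′ → xs ≡ xs′
  ++-injectiveˡ {xs} {xs′} {ys} {ys′} |xs|≡|xs′| eq = begin
    xs                                ≡⟨ take-length-++ xs ys ⟨
    take (length xs) (xs ++ ys)       ≡⟨ cong₂ take |xs|≡|xs′| eq ⟩
    take (length xs′) (xs′ ++ ys′)    ≡⟨ take-length-++ xs′ ys′ ⟩
    xs′                               ∎
    where open ≡-Reasoning

  record PalindromeFactorisation (d : ℕ) (Λ : List ℕ) : Set where
    field
      left right       : List ℕ
      split            : Λ ≡ left ++ right
      palindromic-left  : Palindromic left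
      palindromic-right : Palindromic right
      length-left       : length left ≡ 2 * d
      half-right        : ℕ
      length-right      : length right ≡ 2 * half-right

  rotate-palindromic : ∀ {d Λ} → PalindromeFactorisation d Λ → Palindromic (C d Λ)
  rotate-palindromic {d} {Λ} fact = subst Palindromic (sym rotated) (palindromic-conjugate D palindromic-right)
    where
    open PalindromeFactorisation fact
    T = take d left
    D = drop d left
    d≤|left| : d ≤ length left
    d≤|left| = subst (d ≤_) (sym length-left) (m≤m+n d (d + 0))
    |T|≡d : length T ≡ d
    |T|≡d = trans (length-take d left) (m≤n⇒m⊓n≡m d≤|left|)
    |D|≡d : length D ≡ d
    |D|≡d = trans (length-drop d left) (trans (cong (_∸ d) length-left) (trans (m+n∸m≡n d (d + 0)) (+-identityʳ d)))
    T≡D̃ : T ≡ reverse D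
    T≡D̃ = ++-injectiveˡ (trans |T|≡d (trans (sym |D|≡d) (sym (length-reverse D)))) (begin
      T ++ D                ≡⟨ take++drop≡id d left ⟩
      left                  ≡⟨ palindromic-left ⟩
      reverse left          ≡⟨ cong reverse (take++drop≡id d left) ⟨
      reverse (T ++ D)      ≡⟨ reverse-++ T D ⟩
      reverse D ++ reverse T ∎)
      where open ≡-Reasoning
    rotated : C d Λ ≡ D ++ right ++ reverse D
    rotated = begin
      C d Λ                           ≡⟨ cong (C d) (trans split (cong (_++ right) (sym (take++drop≡id d left)))) ⟩
      C d ((T ++ D) ++ right)         ≡⟨ cong₂ C (sym |T|≡d) (++-assoc T D right) ⟩
      C (length T) (T ++ D ++ right)  ≡⟨ rotate-length-++ T (D ++ right) ⟩
      (D ++ right) ++ T               ≡⟨ ++-assoc D right T ⟩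
      D ++ right ++ T                 ≡⟨ cong (λ W → D ++ right ++ W) T≡D̃ ⟩
      D ++ right ++ reverse D         ∎
      where open ≡-Reasoning

module Lookup where
  open import Data.Maybe using (just)
  open import Data.Nat
  open import Data.Nat.Properties
  open import Data.Sum using (inj₁; inj₂)

  at-++ˡ : ∀ (xs ys : List ℕ) {u} → u < length xs → at (xs ++ ys) u ≡ at xs u
  at-++ˡ (x ∷ xs) ys {zero}  _         = refl
  at-++ˡ (x ∷ xs) ys {suc u} (s≤s u<) = at-++ˡ xs ys u<

  at-++ʳ : ∀ (xs ys : List ℕ) u → at (xs ++ ys) (length xs + u) ≡ at ys u
  at-++ʳ []       ys u = refl
  at-++ʳ (x ∷ xs) ys u = at-++ʳ xs ys u

  at-drop : ∀ j (xs : List ℕ) u → at (drop j xs) u ≡ at xs (j + u)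
  at-drop zero    xs       u = refl
  at-drop (suc j) []       u = refl
  at-drop (suc j) (x ∷ xs) u = at-drop j xs u

  at-take : ∀ j (xs : List ℕ) {u} → u < j → at (take j xs) u ≡ at xs u
  at-take (suc j) []       _                = refl
  at-take (suc j) (x ∷ xs) {zero}  _        = refl
  at-take (suc j) (x ∷ xs) {suc u} (s≤s u<j) = at-take j xs u<j

  at-reverse : ∀ (xs : List ℕ) {u} → u < length xs → at (reverse xs) u ≡ at xs (length xs ∸ suc u)
  at-reverse (x ∷ xs) {u} u<1+n rewrite unfold-reverse x xs with m≤n⇒m<n∨m≡n (s≤s⁻¹ u<1+n)
  ... | inj₁ u<n  = begin
    at (reverse xs ∷ʳ x) u          ≡⟨ at-++ˡ (reverse xs) (x ∷ []) (subst (u <_) (sym (length-reverse xs)) u<n) ⟩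
    at (reverse xs) u               ≡⟨ at-reverse xs u<n ⟩
    at xs (length xs ∸ suc u)       ≡⟨ cong (at (x ∷ xs)) (+-∸-assoc 1 u<n) ⟨
    at (x ∷ xs) (suc (length xs) ∸ suc u) ∎
    where open ≡-Reasoning
  ... | inj₂ refl = begin
    at (reverse xs ∷ʳ x) (length xs)
      ≡⟨ cong (at (reverse xs ∷ʳ x)) (trans (+-identityʳ _) (length-reverse xs)) ⟨
    at (reverse xs ∷ʳ x) (length (reverse xs) + 0) ≡⟨ at-++ʳ (reverse xs) (x ∷ []) 0 ⟩
    just x                                         ≡⟨ cong (at (x ∷ xs)) (n∸n≡0 (length xs)) ⟨
    at (x ∷ xs) (length xs ∸ length xs)            ∎
    where open ≡-Reasoning

  at-rotate-inside : ∀ j (xs : List ℕ) {u} → j + u < length xs → at (C j xs) u ≡ at xs (j + u)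
  at-rotate-inside j xs {u} j+u<n = trans (at-++ˡ (drop j xs) (take j xs) u<) (at-drop j xs u)
    where
    u< : u < length (drop j xs)
    u< = subst (u <_) (sym (length-drop j xs))
           (m+n≤o⇒m≤o∸n (suc u) (subst (_≤ length xs) (cong suc (+-comm j u)) j+u<n))

  at-rotate-wrap : ∀ j (xs : List ℕ) {w} → j ≤ length xs → w < j → at (C j xs) (length xs ∸ j + w) ≡ at xs w
  at-rotate-wrap j xs {w} j≤n w<j = begin
    at (C j xs) (length xs ∸ j + w)               ≡⟨ cong (λ i → at (C j xs) (i + w)) (length-drop j xs) ⟨
    at (C j xs) (length (drop j xs) + w)          ≡⟨ at-++ʳ (drop j xs) (take j xs) w ⟩
    at (take j xs) w                              ≡⟨ at-take j xs w<j ⟩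
    at xs w                                       ∎
    where open ≡-Reasoning

module EvenPalindromes where
  open import Data.Nat as ℕ using (suc; _∸_; s≤s)
  import Data.Nat.Properties as ℕ
  open import Data.Integer using (+_; -[1+_]; +[1+_]; +0; _+_; _-_; _*_; -_; 0ℤ; 1ℤ; -1ℤ; _<_; +<+; -<-)
  open import Data.Integer.Properties
  open import Data.Integer.DivMod using (_%_; _/_; a≡a%n+[a/n]*n; n%d<d)
  open import Data.Integer.Tactic.RingSolver using (solve-∀)
  open import Relation.Nullary using (yes; no)
  open Lookup
  open Palindromes using (PalindromeFactorisation; rotate-palindromic)

  -1<k<1⇒k≡0 : ∀ {k} → -1ℤ < k → k < 1ℤ → k ≡ 0ℤ
  -1<k<1⇒k≡0 {+0} _ _ = refl
  -1<k<1⇒k≡0 {+[1+ _ ]} _ (+<+ (s≤s ()))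
  -1<k<1⇒k≡0 { -[1+ _ ]} (-<- ()) _

  %-unique : ∀ a {u} q {n} .{{_ : ℕ.NonZero n}} → u ℕ.< n → a ≡ + u + q * + n → a % + n ≡ u
  %-unique a {u} q {n} u<n a≡u+qn = +-injective (sym (i-j≡0⇒i≡j (+ u) (+ r) u-r≡0))
    where
    r = a % + n
    s = a / + n
    [s-q]*n≡u-r : (s - q) * + n ≡ + u - + r
    [s-q]*n≡u-r = begin
      (s - q) * + n                                      ≡⟨ difference (+ r) s (+ u) q (+ n) ⟩
      ((+ r + s * + n) - (+ u + q * + n)) + (+ u - + r)
        ≡⟨ cong₂ (λ x y → (x - y) + (+ u - + r)) (a≡a%n+[a/n]*n a (+ n)) a≡u+qn ⟨
      (a - a) + (+ u - + r)                              ≡⟨ cong (_+ (+ u - + r)) (+-inverseʳ a) ⟩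
      0ℤ + (+ u - + r)                                   ≡⟨ +-identityˡ _ ⟩
      + u - + r                                          ∎
      where
      open ≡-Reasoning
      difference : ∀ r s u q n → (s - q) * n ≡ ((r + s * n) - (u + q * n)) + (u - r)
      difference = solve-∀
    upper : (s - q) * + n < 1ℤ * + n
    upper = begin-strict
      (s - q) * + n   ≡⟨ [s-q]*n≡u-r ⟩
      + u - + r       ≤⟨ i-j≤i (+ u) (+ r) ⟩
      + u             <⟨ +<+ u<n ⟩
      + n             ≡⟨ *-identityˡ (+ n) ⟨
      1ℤ * + n        ∎
      where open ≤-Reasoning
    lower : -1ℤ * + n < (s - q) * + n
    lower = begin-strict
      -1ℤ * + n       ≡⟨ -1*i≡-i (+ n) ⟩
      - + n           <⟨ neg-mono-< (+<+ (n%d<d a (+ n))) ⟩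
      - + r           ≤⟨ i≤j+i (- + r) (+ u) ⟩
      + u - + r       ≡⟨ [s-q]*n≡u-r ⟨
      (s - q) * + n   ∎
      where open ≤-Reasoning
    u-r≡0 : + u - + r ≡ 0ℤ
    u-r≡0 = trans (sym [s-q]*n≡u-r) (cong (_* + n) (-1<k<1⇒k≡0
      (*-cancelʳ-<-nonNeg { -1ℤ} {s - q} (+ n) lower) (*-cancelʳ-<-nonNeg {s - q} {1ℤ} (+ n) upper)))

  module _ {n : ℕ} .{{_ : ℕ.NonZero n}} where

    at-rotate-% : ∀ {Λ j} → length Λ ≡ n → j ℕ.≤ n → ∀ t → at (C j Λ) (t % + n) ≡ at Λ ((+ j + t) % + n)
    at-rotate-% {Λ} {j} refl j≤n t with j ℕ.+ t % + n ℕ.<? n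
    ... | yes j+u<n = begin
      at (C j Λ) u                  ≡⟨ at-rotate-inside j Λ j+u<n ⟩
      at Λ (j ℕ.+ u)                ≡⟨ cong (at Λ) (%-unique (+ j + t) q j+u<n shifted) ⟨
      at Λ ((+ j + t) % + n)        ∎
      where
      open ≡-Reasoning
      u = t % + n
      q = t / + n
      shifted : + j + t ≡ + (j ℕ.+ u) + q * + n
      shifted = trans (cong (_+_ (+ j)) (a≡a%n+[a/n]*n t (+ n))) (sym (+-assoc (+ j) (+ u) (q * + n)))
    ... | no  j+u≮n = begin
      at (C j Λ) u                  ≡⟨ cong (at (C j Λ)) u≡n-j+w ⟩
      at (C j Λ) (n ∸ j ℕ.+ w)      ≡⟨ at-rotate-wrap j Λ j≤n w<j ⟩
      at Λ w                        ≡⟨ cong (at Λ) (%-unique (+ j + t) (1ℤ + q) (ℕ.<-≤-trans w<j j≤n) wrapped) ⟨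
      at Λ ((+ j + t) % + n)        ∎
      where
      open ≡-Reasoning
      u = t % + n
      q = t / + n
      w = j ℕ.+ u ∸ n
      n+w≡j+u : n ℕ.+ w ≡ j ℕ.+ u
      n+w≡j+u = ℕ.m+[n∸m]≡n (ℕ.≮⇒≥ j+u≮n)
      u≡n-j+w : u ≡ n ∸ j ℕ.+ w
      u≡n-j+w = ℕ.+-cancelˡ-≡ j u (n ∸ j ℕ.+ w) (begin
        j ℕ.+ u                ≡⟨ n+w≡j+u ⟨
        n ℕ.+ w                ≡⟨ cong (ℕ._+ w) (ℕ.m+[n∸m]≡n j≤n) ⟨
        j ℕ.+ (n ∸ j) ℕ.+ w    ≡⟨ ℕ.+-assoc j (n ∸ j) w ⟩
        j ℕ.+ (n ∸ j ℕ.+ w)    ∎)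
      w<j : w ℕ.< j
      w<j = ℕ.+-cancelˡ-< n w j
        (subst₂ ℕ._<_ (sym n+w≡j+u) (ℕ.+-comm j n) (ℕ.+-monoʳ-< j (n%d<d t (+ n))))
      wrapped : + j + t ≡ + w + (1ℤ + q) * + n
      wrapped = begin
        + j + t                       ≡⟨ cong (_+_ (+ j)) (a≡a%n+[a/n]*n t (+ n)) ⟩
        + j + (+ u + q * + n)         ≡⟨ +-assoc (+ j) (+ u) (q * + n) ⟨
        + (j ℕ.+ u) + q * + n         ≡⟨ cong (λ m → + m + q * + n) n+w≡j+u ⟨
        + n + + w + q * + n           ≡⟨ wrap (+ n) (+ w) q ⟩
        + w + (1ℤ + q) * + n          ∎
        where
        wrap : ∀ n w q → n + w + q * n ≡ w + (1ℤ + q) * n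
        wrap = solve-∀

    at-reflect-% : ∀ {M} → length M ≡ n → Palindromic M → ∀ t → at M (t % + n) ≡ at M ((- t - 1ℤ) % + n)
    at-reflect-% {M} refl M-pal t = begin
      at M u                  ≡⟨ cong (λ xs → at xs u) M-pal ⟩
      at (reverse M) u        ≡⟨ at-reverse M u<n ⟩
      at M (n ∸ suc u)
        ≡⟨ cong (at M) (%-unique (- t - 1ℤ) (- q - 1ℤ) (ℕ.∸-monoʳ-< ℕ.z<s u<n) reflected) ⟨
      at M ((- t - 1ℤ) % + n) ∎
      where
      open ≡-Reasoning
      u = t % + n
      q = t / + n
      u<n = n%d<d t (+ n)
      reflected : - t - 1ℤ ≡ + (n ∸ suc u) + (- q - 1ℤ) * + n
      reflected = begin
        - t - 1ℤ                                 ≡⟨ cong (λ x → - x - 1ℤ) (a≡a%n+[a/n]*n t (+ n)) ⟩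
        - (+ u + q * + n) - 1ℤ                   ≡⟨ reflect (+ u) q (+ n) ⟩
        (+ n - + suc u) + (- q - 1ℤ) * + n
          ≡⟨ cong (_+ (- q - 1ℤ) * + n) (trans (m-n≡m⊖n n (suc u)) (⊖-≥ u<n)) ⟩
        + (n ∸ suc u) + (- q - 1ℤ) * + n         ∎
        where
        reflect : ∀ u q n → - (u + q * n) - 1ℤ ≡ (n - (1ℤ + u)) + (- q - 1ℤ) * n
        reflect = solve-∀

  length-C : ∀ j (xs : List ℕ) → length (C j xs) ≡ length xs
  length-C j xs = trans (length-++-comm (drop j xs) (take j xs)) (cong length (take++drop≡id j xs))

  -- atℤ indexes from 1, so the centre of the rotation by j is k = j + 1.
  palindromic-rotation⇒evenlyPalindromic : ∀ {Λ j h} → j ℕ.≤ length Λ → length Λ ≡ 2 ℕ.* h →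
                                           Palindromic (C j Λ) → EvenlyPalindromic Λ
  palindromic-rotation⇒evenlyPalindromic {[]}        {j} {h} _   |Λ|≡2h _   = h , |Λ|≡2h , + j , λ _ → refl
  palindromic-rotation⇒evenlyPalindromic {Λ@(_ ∷ _)} {j} {h} j≤n |Λ|≡2h pal = h , |Λ|≡2h , + suc j , symmetric
    where
    n = length Λ
    symmetric : ∀ i → atℤ Λ (+ suc j + i) ≡ atℤ Λ (+ suc j - i - 1ℤ)
    symmetric i = begin
      at Λ ((+ suc j + i - 1ℤ) % + n)         ≡⟨ cong (λ x → at Λ (x % + n)) (right (+ j) i) ⟩
      at Λ ((+ j + i) % + n)                  ≡⟨ at-rotate-% refl j≤n i ⟨
      at (C j Λ) (i % + n)                    ≡⟨ at-reflect-% (length-C j Λ) pal i ⟩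
      at (C j Λ) ((- i - 1ℤ) % + n)           ≡⟨ at-rotate-% refl j≤n (- i - 1ℤ) ⟩
      at Λ ((+ j + (- i - 1ℤ)) % + n)         ≡⟨ cong (λ x → at Λ (x % + n)) (left (+ j) i) ⟨
      at Λ ((+ suc j - i - 1ℤ - 1ℤ) % + n)    ∎
      where
      open ≡-Reasoning
      right : ∀ j i → (1ℤ + j) + i - 1ℤ ≡ j + i
      right = solve-∀
      left : ∀ j i → (1ℤ + j) - i - 1ℤ - 1ℤ ≡ j + (- i - 1ℤ)
      left = solve-∀

  factorisation⇒evenlyPalindromic : ∀ {d Λ} → PalindromeFactorisation d Λ → EvenlyPalindromic Λ
  factorisation⇒evenlyPalindromic {d} {Λ} fact =
    palindromic-rotation⇒evenlyPalindromic {h = d ℕ.+ e} d≤|Λ| |Λ|≡2[d+e] (rotate-palindromic fact)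
    where
    open PalindromeFactorisation fact
    e = half-right
    |Λ|≡2[d+e] : length Λ ≡ 2 ℕ.* (d ℕ.+ e)
    |Λ|≡2[d+e] = trans (cong length split) (trans (length-++ left)
      (trans (cong₂ ℕ._+_ length-left length-right) (sym (ℕ.*-distribˡ-+ 2 d e))))
    d≤|Λ| : d ℕ.≤ length Λ
    d≤|Λ| = subst (d ℕ.≤_) (sym |Λ|≡2[d+e]) (ℕ.≤-trans (ℕ.m≤m+n d e) (ℕ.m≤m+n (d ℕ.+ e) _))

module MarkovTriples {α β : List ℕ} (α-pal : Palindromic α) (β-pal : Palindromic β) where
  open import Data.Nat
  open import Data.Nat.Properties
  open import Data.Nat.Tactic.RingSolver using (solve-∀)
  open import Relation.Nullary.Reflects using (ofʸ; ofⁿ)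
  open import Data.Bool using (true; false)
  open import Data.Empty using (⊥-elim)
  open import Function using (_∘_)
  open Diatomic
  open Palindromes

  record Balanced (X′ Z′ : List ℕ) : Set where
    field
      palindromic-Z′α : Palindromic (Z′ ++ α)
      palindromic-βX′ : Palindromic (β ++ X′)
      exchange        : α ++ X′ ++ Z′ ++ β ≡ Z′ ++ α ++ β ++ X′

  module _ {X′ Z′ : List ℕ} (bal : Balanced X′ Z′) where
    open Balanced bal
    open ≡-Reasoning

    private
      Z′α≡αZ̃′ : Z′ ++ α ≡ α ++ reverse Z′
      Z′α≡αZ̃′ = palindromic-++ʳ α-pal palindromic-Z′α

      βX′≡X̃′β : β ++ X′ ≡ reverse X′ ++ β
      βX′≡X̃′β = palindromic-++ˡ β-pal palindromic-βX′

      αX′Z′≡Z′αX̃′ : α ++ X′ ++ Z′ ≡ Z′ ++ α ++ reverse X′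
      αX′Z′≡Z′αX̃′ = ++-cancelʳ β _ _ (begin
        (α ++ X′ ++ Z′) ++ β          ≡⟨ solve (++-monoid ℕ) ⟩
        α ++ X′ ++ Z′ ++ β            ≡⟨ exchange ⟩
        Z′ ++ α ++ β ++ X′            ≡⟨ cong (λ w → Z′ ++ α ++ w) βX′≡X̃′β ⟩
        Z′ ++ α ++ reverse X′ ++ β    ≡⟨ solve (++-monoid ℕ) ⟩
        (Z′ ++ α ++ reverse X′) ++ β  ∎)

      X′Z′β≡Z̃′X̃′β : X′ ++ Z′ ++ β ≡ reverse Z′ ++ reverse X′ ++ β
      X′Z′β≡Z̃′X̃′β = ++-cancelˡ α _ _ (begin
        α ++ X′ ++ Z′ ++ β                      ≡⟨ exchange ⟩
        Z′ ++ α ++ β ++ X′                      ≡⟨ solve (++-monoid ℕ) ⟩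
        (Z′ ++ α) ++ (β ++ X′)                  ≡⟨ cong₂ _++_ Z′α≡αZ̃′ βX′≡X̃′β ⟩
        (α ++ reverse Z′) ++ (reverse X′ ++ β)  ≡⟨ solve (++-monoid ℕ) ⟩
        α ++ reverse Z′ ++ reverse X′ ++ β      ∎)

    balanced-L : Balanced X′ (α ++ X′ ++ Z′)
    balanced-L = record
      { palindromic-Z′α = begin
          (α ++ X′ ++ Z′) ++ α              ≡⟨ cong (_++ α) αX′Z′≡Z′αX̃′ ⟩
          (Z′ ++ α ++ reverse X′) ++ α      ≡⟨ solve (++-monoid ℕ) ⟩
          (Z′ ++ α) ++ reverse X′ ++ α      ≡⟨ reverse-++-palindromes α-pal palindromic-Z′α X′ ⟨
          reverse (α ++ X′ ++ Z′ ++ α)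
            ≡⟨ cong reverse {α ++ X′ ++ Z′ ++ α} {(α ++ X′ ++ Z′) ++ α} (solve (++-monoid ℕ)) ⟩
          reverse ((α ++ X′ ++ Z′) ++ α)    ∎
      ; palindromic-βX′ = palindromic-βX′
      ; exchange = begin
          α ++ X′ ++ (α ++ X′ ++ Z′) ++ β    ≡⟨ solve (++-monoid ℕ) ⟩
          (α ++ X′) ++ (α ++ X′ ++ Z′ ++ β)  ≡⟨ cong ((α ++ X′) ++_) exchange ⟩
          (α ++ X′) ++ (Z′ ++ α ++ β ++ X′)  ≡⟨ solve (++-monoid ℕ) ⟩
          (α ++ X′ ++ Z′) ++ α ++ β ++ X′    ∎
      }

    balanced-R : Balanced (X′ ++ Z′ ++ β) Z′
    balanced-R = record
      { palindromic-Z′α = palindromic-Z′α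
      ; palindromic-βX′ = begin
          β ++ X′ ++ Z′ ++ β                  ≡⟨ cong (β ++_) X′Z′β≡Z̃′X̃′β ⟩
          β ++ reverse Z′ ++ reverse X′ ++ β  ≡⟨ cong (λ w → β ++ reverse Z′ ++ w) βX′≡X̃′β ⟨
          β ++ reverse Z′ ++ β ++ X′          ≡⟨ reverse-++-palindromes palindromic-βX′ β-pal Z′ ⟨
          reverse ((β ++ X′) ++ Z′ ++ β)
            ≡⟨ cong reverse {(β ++ X′) ++ Z′ ++ β} {β ++ X′ ++ Z′ ++ β} (solve (++-monoid ℕ)) ⟩
          reverse (β ++ X′ ++ Z′ ++ β)        ∎
      ; exchange = begin
          α ++ (X′ ++ Z′ ++ β) ++ Z′ ++ β    ≡⟨ solve (++-monoid ℕ) ⟩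
          (α ++ X′ ++ Z′ ++ β) ++ Z′ ++ β    ≡⟨ cong (_++ Z′ ++ β) exchange ⟩
          (Z′ ++ α ++ β ++ X′) ++ Z′ ++ β    ≡⟨ solve (++-monoid ℕ) ⟩
          Z′ ++ α ++ β ++ X′ ++ Z′ ++ β      ∎
      }

  data Standard (N : ℕ) : Triple → Set where
    standard : ∀ {X′ Z′} → Balanced X′ Z′ →
               length (α ++ X′) ≡ 2 * stern N → length (Z′ ++ β) ≡ 2 * stern (suc N) →
               Standard N (α ++ X′ , (α ++ X′) ++ (Z′ ++ β) , Z′ ++ β)

  length-middle : ∀ N (X Z : List ℕ) → length X ≡ 2 * stern N → length Z ≡ 2 * stern (suc N) →
                  length (X ++ Z) ≡ 2 * stern (suc (2 * N))
  length-middle N X Z |X| |Z| = begin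
    length (X ++ Z)                  ≡⟨ length-++ X ⟩
    length X + length Z              ≡⟨ cong₂ _+_ |X| |Z| ⟩
    2 * stern N + 2 * stern (suc N)  ≡⟨ *-distribˡ-+ 2 (stern N) (stern (suc N)) ⟨
    2 * (stern N + stern (suc N))    ≡⟨ cong (2 *_) (stern-double+1 N) ⟨
    2 * stern (suc (2 * N))          ∎
    where open ≡-Reasoning

  standard-L : ∀ {N t} → Standard N t → Standard (2 * N) (opL t)
  standard-L {N} (standard {X′} {Z′} bal |X| |Z|) =
    subst (λ Z → Standard (2 * N) (α ++ X′ , (α ++ X′) ++ Z , Z)) reassoc
      (standard (balanced-L bal)
                (trans |X| (cong (2 *_) (sym (stern-double N))))
                (trans (cong length reassoc) (length-middle N (α ++ X′) (Z′ ++ β) |X| |Z|)))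
    where
    reassoc : (α ++ X′ ++ Z′) ++ β ≡ (α ++ X′) ++ (Z′ ++ β)
    reassoc = solve (++-monoid ℕ)

  standard-R : ∀ {N t} → Standard N t → Standard (suc (2 * N)) (opR t)
  standard-R {N} (standard {X′} {Z′} bal |X| |Z|) =
    subst (λ X → Standard (suc (2 * N)) (X , X ++ (Z′ ++ β) , Z′ ++ β)) reassoc
      (standard (balanced-R bal)
                (trans (cong length reassoc) (length-middle N (α ++ X′) (Z′ ++ β) |X| |Z|))
                (trans |Z| (cong (2 *_) (trans (sym (stern-double (suc N))) (cong stern (*-suc 2 N))))))
    where
    reassoc : α ++ X′ ++ Z′ ++ β ≡ (α ++ X′) ++ (Z′ ++ β)
    reassoc = solve (++-monoid ℕ)

  standard-applyWord : ∀ m {N t k} → k < 2 ^ m → Standard N t →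
                       Standard (2 ^ m * N + k) (applyWord (bitsWord m k) t)
  standard-applyWord zero {N} {t} {zero} _ st =
    subst (λ M → Standard M t) (sym (trans (+-identityʳ _) (*-identityˡ N))) st
  standard-applyWord zero {k = suc _} (s≤s ())
  standard-applyWord (suc m) {N} {t} {k} k<2^[1+m] st with 2 ^ m ≤ᵇ k | ≤ᵇ-reflects-≤ (2 ^ m) k
  ... | true  | ofʸ 2^m≤k = subst (λ M → Standard M (applyWord (bitsWord m (k ∸ 2 ^ m)) (opR t))) index
                              (standard-applyWord m k∸2^m<2^m (standard-R st))
    where
    k∸2^m<2^m : k ∸ 2 ^ m < 2 ^ m
    k∸2^m<2^m = subst (k ∸ 2 ^ m <_) (trans (m+n∸m≡n (2 ^ m) (2 ^ m + 0)) (+-identityʳ (2 ^ m)))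
                  (∸-monoˡ-< k<2^[1+m] 2^m≤k)
    index : 2 ^ m * suc (2 * N) + (k ∸ 2 ^ m) ≡ 2 ^ suc m * N + k
    index = trans (expand (2 ^ m) N (k ∸ 2 ^ m)) (cong (2 ^ suc m * N +_) (m+[n∸m]≡n 2^m≤k))
      where
      expand : ∀ p N r → p * (1 + 2 * N) + r ≡ 2 * p * N + (p + r)
      expand = solve-∀
  ... | false | ofⁿ 2^m≰k = subst (λ M → Standard M (applyWord (bitsWord m k) (opL t))) index
                              (standard-applyWord m (≰⇒> 2^m≰k) (standard-L st))
    where
    index : 2 ^ m * (2 * N) + k ≡ 2 ^ suc m * N + k
    index = cong (_+ k) (trans (sym (*-assoc (2 ^ m) 2 N)) (cong (_* N) (*-comm (2 ^ m) 2)))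

  standard-base : length α ≡ 2 → length β ≡ 2 → Standard 1 (α , α ⊕ β , β)
  standard-base |α| |β| = subst (λ X → Standard 1 (X , X ++ β , β)) (++-identityʳ α)
    (standard balanced-base (trans (cong length (++-identityʳ α)) |α|) |β|)
    where
    balanced-base : Balanced [] []
    balanced-base = record
      { palindromic-Z′α = α-pal
      ; palindromic-βX′ = subst Palindromic (sym (++-identityʳ β)) β-pal
      ; exchange        = cong (α ++_) (sym (++-identityʳ β))
      }

  n<2^n : ∀ n → n < 2 ^ n
  n<2^n zero    = s≤s z≤n
  n<2^n (suc n) = begin-strict
    suc n            <⟨ s≤s (n<2^n n) ⟩
    1 + 2 ^ n        ≤⟨ +-monoˡ-≤ (2 ^ n) (m^n>0 2 n) ⟩
    2 ^ n + 2 ^ n    ≡⟨ cong (2 ^ n +_) (+-identityʳ (2 ^ n)) ⟨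
    2 ^ suc n        ∎
    where open ≤-Reasoning

  SAux-middle : ∀ fuel {m n} → 2 ^ m < n → n ≤ 2 ^ (m + fuel) →
                ∃₂ λ m′ k → n ≡ suc (2 ^ m′ + k) × k < 2 ^ m′ ×
                            SAux α β fuel m n ≡ middle (tripleAt α β m′ (suc k))
  SAux-middle zero {m} 2^m<n n≤2^[m+0] =
    ⊥-elim (<⇒≱ 2^m<n (subst (λ e → _ ≤ 2 ^ e) (+-identityʳ m) n≤2^[m+0]))
  SAux-middle (suc fuel) {m} {n} 2^m<n n≤2^[m+1+fuel] with n ≤ᵇ 2 ^ m * 2 | ≤ᵇ-reflects-≤ n (2 ^ m * 2)
  ... | false | ofⁿ n≰2^m*2 = SAux-middle fuel {suc m}
    (subst (_< n) (*-comm (2 ^ m) 2) (≰⇒> n≰2^m*2)) (subst (λ e → n ≤ 2 ^ e) (+-suc m fuel) n≤2^[m+1+fuel])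
  ... | true  | ofʸ n≤2^m*2 with m≤n⇒∃[o]m+o≡n 2^m<n
  ...   | k , refl = m , k , refl , k<2^m , cong (middle ∘ tripleAt α β m) offset
    where
    k<2^m : k < 2 ^ m
    k<2^m = +-cancelˡ-< (2 ^ m) k (2 ^ m)
      (subst (suc (2 ^ m + k) ≤_) (trans (*-comm (2 ^ m) 2) (cong (2 ^ m +_) (+-identityʳ (2 ^ m)))) n≤2^m*2)
    offset : suc (2 ^ m + k) ∸ 2 ^ m ≡ suc k
    offset = trans (+-∸-assoc 1 (m≤m+n (2 ^ m) k)) (cong suc (m+n∸m≡n (2 ^ m) k))

  S-standard : length α ≡ 2 → length β ≡ 2 →
               ∀ N → ∃ λ t → Standard (suc N) t × S α β (suc (suc N)) ≡ middle t
  S-standard |α| |β| zero    = (α , α ⊕ β , β) , standard-base |α| |β| , refl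
  S-standard |α| |β| (suc N)
    with SAux-middle n {1} (s≤s (s≤s (s≤s z≤n))) (≤-trans (<⇒≤ (n<2^n n)) (m≤m+n (2 ^ n) _))
    where n = suc (suc (suc N))
  ... | m , k , n≡1+2^m+k , k<2^m , S≡ =
    tripleAt α β m (suc k) ,
    subst (λ M → Standard M (tripleAt α β m (suc k))) index
          (standard-applyWord m k<2^m (standard-base |α| |β|)) ,
    S≡
    where
    index : 2 ^ m * 1 + k ≡ suc (suc N)
    index = trans (cong (_+ k) (*-identityʳ (2 ^ m))) (sym (suc-injective n≡1+2^m+k))

  S-factorisation : length α ≡ 2 → length β ≡ 2 → ∀ i → PalindromeFactorisation (stern i) (S α β i)
  S-factorisation |α| |β| 0 = record
    { left = [] ; right = α ; split = refl
    ; palindromic-left = refl ; palindromic-right = α-pal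
    ; length-left = refl ; half-right = 1 ; length-right = |α|
    }
  S-factorisation |α| |β| 1 = record
    { left = β ; right = [] ; split = sym (++-identityʳ β)
    ; palindromic-left = β-pal ; palindromic-right = refl
    ; length-left = |β| ; half-right = 0 ; length-right = refl
    }
  S-factorisation |α| |β| (suc (suc N)) with S-standard |α| |β| N
  ... | _ , standard {X′} {Z′} bal |X| |Z| , S≡ = record
    { left = Z′ ++ α ; right = β ++ X′
    ; split = trans S≡ (begin
        (α ++ X′) ++ (Z′ ++ β)  ≡⟨ solve (++-monoid ℕ) ⟩
        α ++ X′ ++ Z′ ++ β      ≡⟨ exchange ⟩
        Z′ ++ α ++ β ++ X′      ≡⟨ solve (++-monoid ℕ) ⟩
        (Z′ ++ α) ++ (β ++ X′)  ∎)
    ; palindromic-left = palindromic-Z′α ; palindromic-right = palindromic-βX′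
    ; length-left = trans |Z′α|≡|Z′β| |Z|
    ; half-right = stern (suc N)
    ; length-right = trans |βX′|≡|αX′| |X|
    }
    where
    open Balanced bal
    open ≡-Reasoning
    |Z′α|≡|Z′β| : length (Z′ ++ α) ≡ length (Z′ ++ β)
    |Z′α|≡|Z′β| = trans (length-++ Z′) (trans (cong (length Z′ +_) (trans |α| (sym |β|))) (sym (length-++ Z′)))
    |βX′|≡|αX′| : length (β ++ X′) ≡ length (α ++ X′)
    |βX′|≡|αX′| = trans (length-++ β) (trans (cong (_+ length X′) (trans |β| (sym |α|))) (sym (length-++ α)))

open Palindromes using (rotate-palindromic)
open EvenPalindromes using (factorisation⇒evenlyPalindromic)

proposition2p2 : (a b : ℕ) → a > 0 → b > 0 →
    (∀ (i : ℕ) → EvenlyPalindromic (S (a ∷ a ∷ []) (b ∷ b ∷ []) i))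
    × (∀ (i : ℕ) → Palindromic (C (stern i) (S (a ∷ a ∷ []) (b ∷ b ∷ []) i)))
proposition2p2 a b _ _ =
  (λ i → factorisation⇒evenlyPalindromic (factorisation i)) , (λ i → rotate-palindromic (factorisation i))
  where
  open MarkovTriples {a ∷ a ∷ []} {b ∷ b ∷ []} refl refl using (S-factorisation)
  factorisation = S-factorisation refl refl
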